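{- Let $\Gamma$ be a maximal $\mathbb{SKHM}$-consistent set of formulas and let $\Phi_\Gamma$ be the set of all maximal $\mathbb{SKHM}$-consistent sets $\Delta$ such that $\Delta$ and $\Gamma$ contain exactly the same formulas of the form $\mathcal{K}hm(\psi,\chi,\phi)$. For every formula $\phi$: if $\phi\in\Delta$ for all $\Delta\in\Phi_\Gamma$, then $\mathcal{U}\phi\in\Delta$ for all $\Delta\in\Phi_\Gamma$.
   Context: Formulas over a countable set $\mathbf{P}$ of proposition letters: $\phi::=p\mid\neg\phi\mid(\phi\wedge\phi)\mid \mathcal{K}hm(\phi,\phi,\phi)$; $\top,\bot,\vee,\to$ usual abbreviations; $\mathcal{U}\phi$ abbreviates $\mathcal{K}hm(\neg\phi,\top,\bot)$. The system $\mathbb{SKHM}$ (with $p,q,r,o,p',q',o'$ proposition letters) has axioms: TAUT all propositional tautologies; DISTU $\mathcal{U}p\wedge\mathcal{U}(p\to q)\to\mathcal{U}q$; TU $\mathcal{U}p\to p$; 4KhmU $\mathcal{K}hm(p,o,q)\to\mathcal{U}\mathcal{K}hm(p,o,q)$; 5KhmU $\neg\mathcal{K}hm(p,o,q)\to\mathcal{U}\neg\mathcal{K}hm(p,o,q)$; EMPKhm $\mathcal{U}(p\to q)\to\mathcal{K}hm(p,\bot,q)$; COMPKhm $\mathcal{K}hm(p,o,r)\wedge\mathcal{K}hm(r,o,q)\wedge\mathcal{U}(r\to o)\to\mathcal{K}hm(p,o,q)$; ONEKhm $\mathcal{K}hm(p,o,q)\wedge\neg\mathcal{K}hm(p,\bot,q)\to\mathcal{K}hm(p,\bot,o)$;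 UKhm $\mathcal{U}(p'\to p)\wedge\mathcal{U}(o\to o')\wedge\mathcal{U}(q\to q')\wedge\mathcal{K}hm(p,o,q)\to\mathcal{K}hm(p',o',q')$; rules MP, NECU (from $\varphi$ infer $\mathcal{U}\varphi$), SUB (uniform substitution). -}

module Defs where

open import Data.Nat using (ℕ)
open import Data.Bool using (Bool; true; false; not; _∧_)
open import Data.List using (List; []; _∷_; foldr)
open import Data.List.Relation.Unary.All using (All)
open import Data.Product using (Σ; _×_)
open import Data.Sum using (_⊎_)
open import Relation.Binary.PropositionalEquality using (_≡_)
open import Relation.Nullary using (¬_)
open import Relation.Unary using (Pred; _∈_)
open import Level using (0ℓ)

data Form : Set where
  var  : ℕ → Form
  ~_   : Form → Form
  _∧'_ : Form → Form → Form
  Khm  : Form → Form → Form → Form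

infix  40 ~_
infixr 30 _∧'_
infixr 20 _⇒_ _∨'_

⊤' : Form
⊤' = ~ (var 0 ∧' ~ var 0)

⊥' : Form
⊥' = ~ ⊤'

_∨'_ : Form → Form → Form
φ ∨' ψ = ~ (~ φ ∧' ~ ψ)

_⇒_ : Form → Form → Form
φ ⇒ ψ = ~ (φ ∧' ~ ψ)

U : Form → Form
U φ = Khm (~ φ) ⊤' ⊥'

eval : (Form → Bool) → Form → Bool
eval v (var p)     = v (var p)
eval v (~ φ)       = not (eval v φ)
eval v (φ ∧' ψ)    = eval v φ ∧ eval v ψ
eval v (Khm a b c) = v (Khm a b c)

Taut : Form → Set
Taut φ = ∀ (v : Form → Bool) → eval v φ ≡ true

sub : (ℕ → Form) → Form → Form
sub σ (var p)     = σ p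
sub σ (~ φ)       = ~ sub σ φ
sub σ (φ ∧' ψ)    = sub σ φ ∧' sub σ ψ
sub σ (Khm a b c) = Khm (sub σ a) (sub σ b) (sub σ c)

p q r o p'' q'' o'' : Form
p = var 0
q = var 1
r = var 2
o = var 3
p'' = var 4
q'' = var 5
o'' = var 6

data ⊢_ : Form → Set where
  TAUT    : ∀ {φ} → Taut φ → ⊢ φ
  DISTU   : ⊢ (U p ∧' U (p ⇒ q) ⇒ U q)
  TU      : ⊢ (U p ⇒ p)
  4KhmU   : ⊢ (Khm p o q ⇒ U (Khm p o q))
  5KhmU   : ⊢ (~ Khm p o q ⇒ U (~ Khm p o q))
  EMPKhm  : ⊢ (U (p ⇒ q) ⇒ Khm p ⊥' q)
  COMPKhm : ⊢ (Khm p o r ∧' Khm r o q ∧' U (r ⇒ o) ⇒ Khm p o q)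
  ONEKhm  : ⊢ (Khm p o q ∧' ~ Khm p ⊥' q ⇒ Khm p ⊥' o)
  UKhm    : ⊢ (U (p'' ⇒ p) ∧' U (o ⇒ o'') ∧' U (q ⇒ q'') ∧' Khm p o q
               ⇒ Khm p'' o'' q'')
  MP      : ∀ {φ ψ} → ⊢ φ → ⊢ (φ ⇒ ψ) → ⊢ ψ
  NECU    : ∀ {φ} → ⊢ φ → ⊢ U φ
  SUB     : ∀ {φ} (σ : ℕ → Form) → ⊢ φ → ⊢ sub σ φ

FSet : Set₁
FSet = Pred Form 0ℓ

conj : List Form → Form
conj = foldr _∧'_ ⊤'

Consistent : FSet → Set
Consistent Γ = ¬ Σ (List Form) (λ L → All (_∈ Γ) L × ⊢ (~ conj L))

_+ₛ_ : FSet → Form → FSet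
(Γ +ₛ φ) ψ = Γ ψ ⊎ ψ ≡ φ

MCS : FSet → Set
MCS Γ = Consistent Γ × (∀ φ → Consistent (Γ +ₛ φ) → φ ∈ Γ)

InΦ : FSet → FSet → Set
InΦ Γ Δ = MCS Δ × (∀ a b c → (Khm a b c ∈ Δ → Khm a b c ∈ Γ)
                           × (Khm a b c ∈ Γ → Khm a b c ∈ Δ))

-- If φ holds throughout Φ_Γ then ¬φ is inconsistent with the Khm-literals
-- of Γ (a Lindenbaum extension would otherwise lie in Φ_Γ and refute φ), so
-- some finite conjunction κ of them proves φ. By 4KhmU and 5KhmU every
-- Khm-literal, hence κ, implies its own universal closure, so κ → U κ → U φ
-- and U φ ∈ Γ. Since U φ is itself a Khm-formula, it lies in every Δ ∈ Φ_Γ.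
module Submission where

open import Defs
open import Data.Bool using (Bool; true; false; not; _∧_; T)
open import Data.Bool.Properties using (T-∧; T-≡)
open import Data.Fin as Fin using (Fin)
open import Data.List using (List; []; _∷_; _++_; map; foldl; cartesianProductWith; cartesianProduct)
open import Data.List.Membership.Propositional using () renaming (_∈_ to _∈ₗ_)
open import Data.List.Membership.Propositional.Properties
  using (∈-++⁺ˡ; ∈-++⁺ʳ; ∈-map⁺; ∈-cartesianProductWith⁺; ∈-cartesianProduct⁺)
open import Data.List.Relation.Unary.All using (All; []; _∷_)
import Data.List.Relation.Unary.All as All
open import Data.List.Relation.Unary.All.Properties using (++⁺)
open import Data.List.Relation.Unary.Any using (here; there)
open import Data.Nat using (ℕ; zero; suc; _≤_; _⊔_; _≤′_; ≤′-refl; ≤′-step)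
open import Data.Nat.Properties using (≤⇒≤′; ≤-trans; m≤m⊔n; m≤n⊔m)
open import Data.Product using (Σ; ∃; _×_; _,_; proj₁; proj₂; uncurry)
open import Data.Sum using (_⊎_; inj₁; inj₂)
open import Data.Vec using (Vec; []; _∷_; lookup)
import Data.Vec as Vec
open import Data.Vec.Properties using (lookup-map)
open import Data.Empty using (⊥)
open import Function using (_∘_; Equivalence)
open import Relation.Binary.PropositionalEquality using (_≡_; refl; sym; trans; cong; cong₂; subst)
open import Relation.Nullary using (¬_)
open import Relation.Unary using (_∈_; _⊆_)

data Schema (n : ℕ) : Set where
  `_   : Fin n → Schema n
  ¬ₛ_  : Schema n → Schema n
  _∧ₛ_ : Schema n → Schema n → Schema n

infix  40 ¬ₛ_
infixr 30 _∧ₛ_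
infixr 20 _⇒ₛ_

_⇒ₛ_ : ∀ {n} → Schema n → Schema n → Schema n
s ⇒ₛ t = ¬ₛ (s ∧ₛ ¬ₛ t)

⊤ₛ : ∀ {n} → Schema n → Schema n
⊤ₛ s = ¬ₛ (s ∧ₛ ¬ₛ s)

x₀ : ∀ {n} → Schema (suc n)
x₀ = ` Fin.zero

x₁ : ∀ {n} → Schema (suc (suc n))
x₁ = ` Fin.suc Fin.zero

x₂ : ∀ {n} → Schema (suc (suc (suc n)))
x₂ = ` Fin.suc (Fin.suc Fin.zero)

x₃ : ∀ {n} → Schema (suc (suc (suc (suc n))))
x₃ = ` Fin.suc (Fin.suc (Fin.suc Fin.zero))

x₄ : ∀ {n} → Schema (suc (suc (suc (suc (suc n)))))
x₄ = ` Fin.suc (Fin.suc (Fin.suc (Fin.suc Fin.zero)))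

x₅ : ∀ {n} → Schema (suc (suc (suc (suc (suc (suc n))))))
x₅ = ` Fin.suc (Fin.suc (Fin.suc (Fin.suc (Fin.suc Fin.zero))))

instantiate : ∀ {n} → Vec Form n → Schema n → Form
instantiate xs (` i)    = lookup xs i
instantiate xs (¬ₛ s)   = ~ instantiate xs s
instantiate xs (s ∧ₛ t) = instantiate xs s ∧' instantiate xs t

truth : ∀ {n} → Vec Bool n → Schema n → Bool
truth bs (` i)    = lookup bs i
truth bs (¬ₛ s)   = not (truth bs s)
truth bs (s ∧ₛ t) = truth bs s ∧ truth bs t

eval-instantiate : ∀ {n} v (xs : Vec Form n) s →
                   eval v (instantiate xs s) ≡ truth (Vec.map (eval v) xs) s
eval-instantiate v xs (` i)    = sym (lookup-map i (eval v) xs)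
eval-instantiate v xs (¬ₛ s)   = cong not (eval-instantiate v xs s)
eval-instantiate v xs (s ∧ₛ t) = cong₂ _∧_ (eval-instantiate v xs s) (eval-instantiate v xs t)

everywhere : ∀ n → (Vec Bool n → Bool) → Bool
everywhere zero    f = f []
everywhere (suc n) f = everywhere n (f ∘ (true ∷_)) ∧ everywhere n (f ∘ (false ∷_))

everywhere-sound : ∀ n {f} → T (everywhere n f) → ∀ bs → T (f bs)
everywhere-sound zero    t []           = t
everywhere-sound (suc n) t (true ∷ bs)  = everywhere-sound n (proj₁ (Equivalence.to T-∧ t)) bs
everywhere-sound (suc n) t (false ∷ bs) = everywhere-sound n (proj₂ (Equivalence.to T-∧ t)) bs

-- The implicit argument evaluates the truth table; for a valid schema it
-- reduces to the unit type and is solved automatically.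
tautology : ∀ {n} (s : Schema n) {_ : T (everywhere n (λ bs → truth bs s))} (xs : Vec Form n) →
            ⊢ instantiate xs s
tautology {n} s {valid} xs = TAUT λ v →
  trans (eval-instantiate v xs s) (Equivalence.to T-≡ (everywhere-sound n valid (Vec.map (eval v) xs)))

⇒-trans : ∀ {A B C} → ⊢ (A ⇒ B) → ⊢ (B ⇒ C) → ⊢ (A ⇒ C)
⇒-trans {A} {B} {C} ab bc =
  MP bc (MP ab (tautology ((x₀ ⇒ₛ x₁) ⇒ₛ (x₁ ⇒ₛ x₂) ⇒ₛ (x₀ ⇒ₛ x₂)) (A ∷ B ∷ C ∷ [])))

assign : List Form → ℕ → Form
assign []       n       = var n
assign (x ∷ xs) zero    = x
assign (x ∷ xs) (suc n) = assign xs n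

⊤[_] : Form → Form
⊤[ a ] = ~ (a ∧' ~ a)

-- ⊤' is ⊤[ p ], so a substitution instance of an axiom mentioning U φ
-- contains Uat (σ 0) (sub σ φ) rather than U (sub σ φ).
Uat : Form → Form → Form
Uat a φ = Khm (~ φ) ⊤[ a ] (~ ⊤[ a ])

sub-lower-raise : ∀ a φ → sub (assign (a ∷ [])) (sub (var ∘ suc) φ) ≡ φ
sub-lower-raise a (var n)     = refl
sub-lower-raise a (~ φ)       = cong ~_ (sub-lower-raise a φ)
sub-lower-raise a (φ ∧' ψ)    = cong₂ _∧'_ (sub-lower-raise a φ) (sub-lower-raise a ψ)
sub-lower-raise a (Khm φ ψ χ) =
  cong₂ (λ φ′ → uncurry (Khm φ′)) (sub-lower-raise a φ) (cong₂ _,_ (sub-lower-raise a ψ) (sub-lower-raise a χ))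

-- Move φ out of the way of p, necessitate, and substitute a for p.
NECUat : ∀ a {φ} → ⊢ φ → ⊢ Uat a φ
NECUat a {φ} ⊢φ =
  subst (⊢_ ∘ Uat a) (sub-lower-raise a φ) (SUB (assign (a ∷ [])) (NECU (SUB (var ∘ suc) ⊢φ)))

Uat-change : ∀ a b φ → ⊢ (Uat a φ ⇒ Uat b φ)
Uat-change a b φ = MP (NECUat (~ φ) ⊥-mono) (MP (NECUat (~ φ) ⊤-mono) (MP (NECUat (~ φ) ¬φ-refl) discharge))
  where
  ¬φ-refl : ⊢ (~ φ ⇒ ~ φ)
  ¬φ-refl = tautology (x₀ ⇒ₛ x₀) (~ φ ∷ [])
  ⊤-mono : ⊢ (⊤[ a ] ⇒ ⊤[ b ])
  ⊤-mono = tautology (⊤ₛ x₀ ⇒ₛ ⊤ₛ x₁) (a ∷ b ∷ [])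
  ⊥-mono : ⊢ (~ ⊤[ a ] ⇒ ~ ⊤[ b ])
  ⊥-mono = tautology (¬ₛ ⊤ₛ x₀ ⇒ₛ ¬ₛ ⊤ₛ x₁) (a ∷ b ∷ [])
  discharge : ⊢ (Uat (~ φ) (~ φ ⇒ ~ φ) ⇒ Uat (~ φ) (⊤[ a ] ⇒ ⊤[ b ]) ⇒ Uat (~ φ) (~ ⊤[ a ] ⇒ ~ ⊤[ b ])
                 ⇒ Uat a φ ⇒ Uat b φ)
  discharge = MP (SUB (assign (~ φ ∷ ~ ⊤[ a ] ∷ var 2 ∷ ⊤[ a ] ∷ ~ φ ∷ ~ ⊤[ b ] ∷ ⊤[ b ] ∷ [])) UKhm)
                 (tautology ((x₀ ∧ₛ x₁ ∧ₛ x₂ ∧ₛ x₃ ⇒ₛ x₄) ⇒ₛ x₀ ⇒ₛ x₁ ⇒ₛ x₂ ⇒ₛ x₃ ⇒ₛ x₄)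
                   (Uat (~ φ) (~ φ ⇒ ~ φ) ∷ Uat (~ φ) (⊤[ a ] ⇒ ⊤[ b ]) ∷ Uat (~ φ) (~ ⊤[ a ] ⇒ ~ ⊤[ b ])
                    ∷ Uat a φ ∷ Uat b φ ∷ []))

U-dist : ∀ A B → ⊢ (U A ∧' U (A ⇒ B) ⇒ U B)
U-dist A B = MP (Uat-change A (var 0) B) (MP DISTU-instance (MP (Uat-change (var 0) A (A ⇒ B))
               (MP (Uat-change (var 0) A A) (tautology
                 ((x₀ ⇒ₛ x₁) ⇒ₛ (x₂ ⇒ₛ x₃) ⇒ₛ (x₁ ∧ₛ x₃ ⇒ₛ x₄) ⇒ₛ (x₄ ⇒ₛ x₅) ⇒ₛ (x₀ ∧ₛ x₂ ⇒ₛ x₅))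
                 (U A ∷ Uat A A ∷ U (A ⇒ B) ∷ Uat A (A ⇒ B) ∷ Uat A B ∷ U B ∷ [])))))
  where
  DISTU-instance : ⊢ (Uat A A ∧' Uat A (A ⇒ B) ⇒ Uat A B)
  DISTU-instance = SUB (assign (A ∷ B ∷ [])) DISTU

U-mono : ∀ {A B} → ⊢ (A ⇒ B) → ⊢ (U A ⇒ U B)
U-mono {A} {B} ⊢A⇒B =
  MP (U-dist A B) (MP (NECU ⊢A⇒B) (tautology (x₁ ⇒ₛ (x₀ ∧ₛ x₁ ⇒ₛ x₂) ⇒ₛ (x₀ ⇒ₛ x₂)) (U A ∷ U (A ⇒ B) ∷ U B ∷ [])))

U-∧ : ∀ A B → ⊢ (U A ∧' U B ⇒ U (A ∧' B))
U-∧ A B = MP (U-dist B (A ∧' B)) (MP (U-mono (tautology (x₀ ⇒ₛ x₁ ⇒ₛ x₀ ∧ₛ x₁) (A ∷ B ∷ [])))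
            (tautology ((x₀ ⇒ₛ x₁) ⇒ₛ (x₂ ∧ₛ x₁ ⇒ₛ x₃) ⇒ₛ (x₀ ∧ₛ x₂ ⇒ₛ x₃))
              (U A ∷ U (B ⇒ A ∧' B) ∷ U B ∷ U (A ∧' B) ∷ [])))

data KhmLiteral : Form → Set where
  pos : ∀ a b c → KhmLiteral (Khm a b c)
  neg : ∀ a b c → KhmLiteral (~ Khm a b c)

KhmLiteral⇒U : ∀ {κ} → KhmLiteral κ → ⊢ (κ ⇒ U κ)
KhmLiteral⇒U (pos a b c) = ⇒-trans (SUB (assign (a ∷ c ∷ var 2 ∷ b ∷ [])) 4KhmU) (Uat-change a (var 0) _)
KhmLiteral⇒U (neg a b c) = ⇒-trans (SUB (assign (a ∷ c ∷ var 2 ∷ b ∷ [])) 5KhmU) (Uat-change a (var 0) _)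

conj⇒U : ∀ {K} → All KhmLiteral K → ⊢ (conj K ⇒ U (conj K))
conj⇒U [] = MP (NECU (tautology (⊤ₛ x₀) (var 0 ∷ []))) (tautology (x₁ ⇒ₛ x₀ ⇒ₛ x₁) (⊤' ∷ U ⊤' ∷ []))
conj⇒U {κ ∷ K} (lit ∷ lits) = MP (U-∧ κ (conj K)) (MP (conj⇒U lits) (MP (KhmLiteral⇒U lit)
  (tautology ((x₀ ⇒ₛ x₁) ⇒ₛ (x₂ ⇒ₛ x₃) ⇒ₛ (x₁ ∧ₛ x₃ ⇒ₛ x₄) ⇒ₛ (x₀ ∧ₛ x₂ ⇒ₛ x₄))
    (κ ∷ U κ ∷ conj K ∷ U (conj K) ∷ U (κ ∧' conj K) ∷ []))))

infix 10 _⊢ₛ_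

_⊢ₛ_ : FSet → Form → Set
Γ ⊢ₛ φ = Σ (List Form) λ L → All (_∈ Γ) L × ⊢ (conj L ⇒ φ)

Inconsistent : FSet → Set
Inconsistent Γ = Σ (List Form) λ L → All (_∈ Γ) L × ⊢ (~ conj L)

Inconsistent-mono : ∀ {Γ Δ} → Γ ⊆ Δ → Inconsistent Γ → Inconsistent Δ
Inconsistent-mono Γ⊆Δ (L , L⊆Γ , ⊢¬L) = L , All.map Γ⊆Δ L⊆Γ , ⊢¬L

⊢⇒⊢ₛ : ∀ {Γ φ} → ⊢ φ → Γ ⊢ₛ φ
⊢⇒⊢ₛ {φ = φ} ⊢φ = [] , [] , MP ⊢φ (tautology (x₁ ⇒ₛ x₀ ⇒ₛ x₁) (⊤' ∷ φ ∷ []))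

∈⇒⊢ₛ : ∀ {Γ φ} → φ ∈ Γ → Γ ⊢ₛ φ
∈⇒⊢ₛ {φ = φ} φ∈Γ = φ ∷ [] , φ∈Γ ∷ [] , tautology (x₀ ∧ₛ x₁ ⇒ₛ x₀) (φ ∷ ⊤' ∷ [])

⊢ₛ-mp : ∀ {Γ A B} → Γ ⊢ₛ A → ⊢ (A ⇒ B) → Γ ⊢ₛ B
⊢ₛ-mp (L , L⊆Γ , ⊢L⇒A) ⊢A⇒B = L , L⊆Γ , ⇒-trans ⊢L⇒A ⊢A⇒B

conj-++ : ∀ L K → ⊢ (conj (L ++ K) ⇒ conj L ∧' conj K)
conj-++ []      K = tautology (x₁ ⇒ₛ ⊤ₛ x₀ ∧ₛ x₁) (var 0 ∷ conj K ∷ [])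
conj-++ (φ ∷ L) K = MP (conj-++ L K)
  (tautology ((x₁ ⇒ₛ x₂ ∧ₛ x₃) ⇒ₛ (x₀ ∧ₛ x₁ ⇒ₛ (x₀ ∧ₛ x₂) ∧ₛ x₃)) (φ ∷ conj (L ++ K) ∷ conj L ∷ conj K ∷ []))

⊢ₛ-∧ : ∀ {Γ A B} → Γ ⊢ₛ A → Γ ⊢ₛ B → Γ ⊢ₛ (A ∧' B)
⊢ₛ-∧ {A = A} {B} (L , L⊆Γ , ⊢L⇒A) (K , K⊆Γ , ⊢K⇒B) = L ++ K , ++⁺ L⊆Γ K⊆Γ ,
  MP ⊢K⇒B (MP ⊢L⇒A (MP (conj-++ L K)
    (tautology ((x₀ ⇒ₛ x₁ ∧ₛ x₂) ⇒ₛ (x₁ ⇒ₛ x₃) ⇒ₛ (x₂ ⇒ₛ x₄) ⇒ₛ (x₀ ⇒ₛ x₃ ∧ₛ x₄))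
      (conj (L ++ K) ∷ conj L ∷ conj K ∷ A ∷ B ∷ []))))

⊢ₛ-contradiction : ∀ {Γ A} → Γ ⊢ₛ A → Γ ⊢ₛ ~ A → Inconsistent Γ
⊢ₛ-contradiction {A = A} ⊢A ⊢¬A with ⊢ₛ-∧ ⊢A ⊢¬A
... | L , L⊆Γ , ⊢L⇒⊥ = L , L⊆Γ , MP ⊢L⇒⊥ (tautology ((x₀ ⇒ₛ x₁ ∧ₛ ¬ₛ x₁) ⇒ₛ ¬ₛ x₀) (conj L ∷ A ∷ []))

deduction : ∀ {Γ χ M} → All (_∈ Γ +ₛ χ) M → Γ ⊢ₛ (χ ⇒ conj M)
deduction {χ = χ} [] = ⊢⇒⊢ₛ (tautology (x₀ ⇒ₛ ⊤ₛ x₁) (χ ∷ var 0 ∷ []))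
deduction {χ = χ} {φ ∷ M} (inj₁ φ∈Γ ∷ M⊆Γ+χ) = ⊢ₛ-mp (⊢ₛ-∧ (∈⇒⊢ₛ φ∈Γ) (deduction M⊆Γ+χ))
  (tautology (x₀ ∧ₛ (x₁ ⇒ₛ x₂) ⇒ₛ (x₁ ⇒ₛ x₀ ∧ₛ x₂)) (φ ∷ χ ∷ conj M ∷ []))
deduction {χ = χ} {_ ∷ M} (inj₂ refl ∷ M⊆Γ+χ) = ⊢ₛ-mp (deduction M⊆Γ+χ)
  (tautology ((x₀ ⇒ₛ x₁) ⇒ₛ (x₀ ⇒ₛ x₀ ∧ₛ x₁)) (χ ∷ conj M ∷ []))

refutation : ∀ {Γ χ} → Inconsistent (Γ +ₛ χ) → Γ ⊢ₛ ~ χ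
refutation {χ = χ} (M , M⊆Γ+χ , ⊢¬M) = ⊢ₛ-mp (deduction M⊆Γ+χ)
  (MP ⊢¬M (tautology (¬ₛ x₁ ⇒ₛ (x₀ ⇒ₛ x₁) ⇒ₛ ¬ₛ x₀) (χ ∷ conj M ∷ [])))

consistent-clash : ∀ {Γ φ} → Consistent Γ → φ ∈ Γ → ~ φ ∈ Γ → ⊥
consistent-clash cΓ φ∈Γ ¬φ∈Γ = cΓ (⊢ₛ-contradiction (∈⇒⊢ₛ φ∈Γ) (∈⇒⊢ₛ ¬φ∈Γ))

MCS-closed : ∀ {Γ φ} → MCS Γ → Γ ⊢ₛ φ → φ ∈ Γ
MCS-closed (cΓ , maxΓ) ⊢φ = maxΓ _ λ inc → cΓ (⊢ₛ-contradiction ⊢φ (refutation inc))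

MCS-¬ : ∀ {Γ φ} → MCS Γ → Inconsistent (Γ +ₛ φ) → ~ φ ∈ Γ
MCS-¬ mΓ = MCS-closed mΓ ∘ refutation

formulas : ℕ → List Form
formulas zero    = []
formulas (suc n) = F ++ var n ∷ map ~_ F ++ cartesianProductWith _∧'_ F F
                     ++ cartesianProductWith (uncurry ∘ Khm) F (cartesianProduct F F)
  where
  F : List Form
  F = formulas n

formulas-mono : ∀ {m n φ} → m ≤ n → φ ∈ₗ formulas m → φ ∈ₗ formulas n
formulas-mono = go ∘ ≤⇒≤′
  where
  go : ∀ {m n φ} → m ≤′ n → φ ∈ₗ formulas m → φ ∈ₗ formulas n
  go ≤′-refl       φ∈ = φ∈
  go (≤′-step m≤n) φ∈ = ∈-++⁺ˡ (go m≤n φ∈)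

var-∈formulas : ∀ n → var n ∈ₗ formulas (suc n)
var-∈formulas n = ∈-++⁺ʳ (formulas n) (here refl)

~-∈formulas : ∀ {n φ} → φ ∈ₗ formulas n → ~ φ ∈ₗ formulas (suc n)
~-∈formulas {n} φ∈ = ∈-++⁺ʳ (formulas n) (there (∈-++⁺ˡ (∈-map⁺ ~_ φ∈)))

∧-∈formulas : ∀ {n φ ψ} → φ ∈ₗ formulas n → ψ ∈ₗ formulas n → φ ∧' ψ ∈ₗ formulas (suc n)
∧-∈formulas {n} φ∈ ψ∈ = ∈-++⁺ʳ (formulas n) (there (∈-++⁺ʳ (map ~_ (formulas n))
  (∈-++⁺ˡ (∈-cartesianProductWith⁺ _∧'_ φ∈ ψ∈))))

Khm-∈formulas : ∀ {n φ ψ χ} → φ ∈ₗ formulas n → ψ ∈ₗ formulas n → χ ∈ₗ formulas n →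
                Khm φ ψ χ ∈ₗ formulas (suc n)
Khm-∈formulas {n} φ∈ ψ∈ χ∈ = ∈-++⁺ʳ (formulas n) (there (∈-++⁺ʳ (map ~_ (formulas n))
  (∈-++⁺ʳ (cartesianProductWith _∧'_ (formulas n) (formulas n))
    (∈-cartesianProductWith⁺ (uncurry ∘ Khm) φ∈ (∈-cartesianProduct⁺ ψ∈ χ∈)))))

formulas-complete : ∀ φ → ∃ λ n → φ ∈ₗ formulas n
formulas-complete (var n) = suc n , var-∈formulas n
formulas-complete (~ φ) with formulas-complete φ
... | n , φ∈ = suc n , ~-∈formulas φ∈
formulas-complete (φ ∧' ψ) with formulas-complete φ | formulas-complete ψ
... | n , φ∈ | m , ψ∈ = suc (n ⊔ m) ,
  ∧-∈formulas (formulas-mono (m≤m⊔n n m) φ∈) (formulas-mono (m≤n⊔m n m) ψ∈)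
formulas-complete (Khm φ ψ χ) with formulas-complete φ | formulas-complete ψ | formulas-complete χ
... | n , φ∈ | m , ψ∈ | l , χ∈ = suc (n ⊔ (m ⊔ l)) ,
  Khm-∈formulas (formulas-mono (m≤m⊔n n (m ⊔ l)) φ∈)
                (formulas-mono (≤-trans (m≤m⊔n m l) (m≤n⊔m n (m ⊔ l))) ψ∈)
                (formulas-mono (≤-trans (m≤n⊔m m l) (m≤n⊔m n (m ⊔ l))) χ∈)

-- Consistency is undecidable, so instead of testing it the new member ψ
-- carries the evidence that adding it is consistent.
_⊕_ : FSet → Form → FSet
(Γ ⊕ ψ) χ = χ ∈ Γ ⊎ (χ ≡ ψ × Consistent (Γ +ₛ ψ))

+ₛ-mono : ∀ {Γ Δ ψ} → Γ ⊆ Δ → Γ +ₛ ψ ⊆ Δ +ₛ ψ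
+ₛ-mono Γ⊆Δ (inj₁ χ∈Γ) = inj₁ (Γ⊆Δ χ∈Γ)
+ₛ-mono Γ⊆Δ (inj₂ χ≡ψ) = inj₂ χ≡ψ

⊕⊆+ₛ : ∀ {Γ ψ} → Γ ⊕ ψ ⊆ Γ +ₛ ψ
⊕⊆+ₛ (inj₁ χ∈Γ)       = inj₁ χ∈Γ
⊕⊆+ₛ (inj₂ (χ≡ψ , _)) = inj₂ χ≡ψ

⊕⊆ : ∀ {Γ ψ} → ¬ Consistent (Γ +ₛ ψ) → Γ ⊕ ψ ⊆ Γ
⊕⊆ _    (inj₁ χ∈Γ)      = χ∈Γ
⊕⊆ ¬cΓψ (inj₂ (_ , cΓψ)) with () ← ¬cΓψ cΓψ

⊕-consistent : ∀ {Γ ψ} → Consistent Γ → Consistent (Γ ⊕ ψ)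
⊕-consistent cΓ inc = cΓ (Inconsistent-mono (⊕⊆ λ cΓψ → cΓψ (Inconsistent-mono ⊕⊆+ₛ inc)) inc)

extend : FSet → List Form → FSet
extend = foldl _⊕_

⊆extend : ∀ {Γ} L → Γ ⊆ extend Γ L
⊆extend []      χ∈Γ = χ∈Γ
⊆extend (ψ ∷ L) χ∈Γ = ⊆extend L (inj₁ χ∈Γ)

extend-consistent : ∀ {Γ} L → Consistent Γ → Consistent (extend Γ L)
extend-consistent []      cΓ = cΓ
extend-consistent (ψ ∷ L) cΓ = extend-consistent L (⊕-consistent cΓ)

∈extend : ∀ {Γ Δ ψ} L → extend Γ L ⊆ Δ → Consistent (Δ +ₛ ψ) → ψ ∈ₗ L → ψ ∈ extend Γ L
∈extend {Γ} {Δ} {ψ} (_ ∷ L) ext⊆Δ cΔψ (here refl) =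
  ⊆extend L (inj₂ (refl , λ inc → cΔψ (Inconsistent-mono (+ₛ-mono {Γ} {Δ} {ψ} Γ⊆Δ) inc)))
  where
  Γ⊆Δ : Γ ⊆ Δ
  Γ⊆Δ χ∈Γ = ext⊆Δ (⊆extend L (inj₁ χ∈Γ))
∈extend (_ ∷ L) ext⊆Δ cΔψ (there ψ∈L) = ∈extend L ext⊆Δ cΔψ ψ∈L

stage : FSet → ℕ → FSet
stage S zero    = S
stage S (suc n) = extend (stage S n) (formulas n)

stage-mono : ∀ S {m n} → m ≤ n → stage S m ⊆ stage S n
stage-mono S = go ∘ ≤⇒≤′
  where
  go : ∀ {m n} → m ≤′ n → stage S m ⊆ stage S n
  go ≤′-refl           φ∈ = φ∈
  go (≤′-step {n} m≤n) φ∈ = ⊆extend (formulas n) (go m≤n φ∈)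

limit : FSet → FSet
limit S φ = ∃ λ n → φ ∈ stage S n

All-limit⇒stage : ∀ S {L} → All (_∈ limit S) L → ∃ λ n → All (_∈ stage S n) L
All-limit⇒stage S [] = zero , []
All-limit⇒stage S ((n , φ∈) ∷ L⊆lim) with All-limit⇒stage S L⊆lim
... | m , L⊆stage = n ⊔ m , stage-mono S (m≤m⊔n n m) φ∈ ∷ All.map (stage-mono S (m≤n⊔m n m)) L⊆stage

lindenbaum : ∀ {S} → Consistent S → Σ FSet λ Δ → MCS Δ × S ⊆ Δ
lindenbaum {S} cS = limit S , (consistent , maximal) , λ φ∈S → zero , φ∈S
  where
  stage-consistent : ∀ n → Consistent (stage S n)
  stage-consistent zero    = cS
  stage-consistent (suc n) = extend-consistent (formulas n) (stage-consistent n)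
  consistent : Consistent (limit S)
  consistent (L , L⊆lim , ⊢¬L) with All-limit⇒stage S L⊆lim
  ... | n , L⊆stage = stage-consistent n (L , L⊆stage , ⊢¬L)
  maximal : ∀ ψ → Consistent (limit S +ₛ ψ) → ψ ∈ limit S
  maximal ψ clim with formulas-complete ψ
  ... | n , ψ∈ = suc n , ∈extend (formulas n) (λ χ∈ → suc n , χ∈) clim ψ∈

KhmTheory : FSet → FSet
KhmTheory Γ φ = φ ∈ Γ × KhmLiteral φ

KhmTheory⊢⇒⊢U : ∀ {Γ φ} → KhmTheory Γ ⊢ₛ φ → Γ ⊢ₛ U φ
KhmTheory⊢⇒⊢U (K , K⊆Th , ⊢K⇒φ) =
  K , All.map proj₁ K⊆Th , ⇒-trans (conj⇒U (All.map proj₂ K⊆Th)) (U-mono ⊢K⇒φ)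

InΦ-if-KhmTheory⊆ : ∀ {Γ Δ} → MCS Γ → MCS Δ → KhmTheory Γ ⊆ Δ → InΦ Γ Δ
InΦ-if-KhmTheory⊆ mΓ mΔ Th⊆Δ = mΔ , λ a b c →
  (λ k∈Δ → proj₂ mΓ _ λ inc → consistent-clash (proj₁ mΔ) k∈Δ (Th⊆Δ (MCS-¬ mΓ inc , neg a b c))) ,
  (λ k∈Γ → Th⊆Δ (k∈Γ , pos a b c))

proposition7 : (Γ : FSet) → MCS Γ → (φ : Form) →
    ((Δ : FSet) → InΦ Γ Δ → φ ∈ Δ) →
    (Δ : FSet) → InΦ Γ Δ → U φ ∈ Δ
proposition7 Γ mΓ φ φ∈Φ Δ (_ , sameKhm) = proj₂ (sameKhm (~ φ) ⊤' ⊥') Uφ∈Γ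
  where
  ¬φ-inconsistent : ¬ Consistent (KhmTheory Γ +ₛ ~ φ)
  ¬φ-inconsistent c with lindenbaum c
  ... | Δ′ , mΔ′ , ⊆Δ′ = consistent-clash (proj₁ mΔ′)
          (φ∈Φ Δ′ (InΦ-if-KhmTheory⊆ mΓ mΔ′ (⊆Δ′ ∘ inj₁))) (⊆Δ′ (inj₂ refl))
  U-from-refutation : Inconsistent (KhmTheory Γ +ₛ ~ φ) → U φ ∈ Γ
  U-from-refutation inc =
    MCS-closed mΓ (KhmTheory⊢⇒⊢U (⊢ₛ-mp (refutation inc) (tautology (¬ₛ ¬ₛ x₀ ⇒ₛ x₀) (φ ∷ []))))
  Uφ∈Γ : U φ ∈ Γ
  Uφ∈Γ = proj₂ mΓ (U φ) λ inc → ¬φ-inconsistent λ inc′ →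
    consistent-clash (proj₁ mΓ) (U-from-refutation inc′) (MCS-¬ mΓ inc)
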